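{- For every graph $G=(V,E)$, it holds that \[ \log\log\chi(G)\le\mathsf{NCC}(\textsc{GraphIneq}_{G})\le\log\log\chi(G)+1. \]
   Context: Logs base 2; $\chi(G)$ is the chromatic number of the (finite) graph $G$. $\textsc{GraphIneq}_G$ is the promise communication problem in which Alice gets a vertex $v_A\in V$ and Bob gets $v_B\in V$; the answer must be $1$ if $v_A$ and $v_B$ are neighbors, $0$ if $v_A=v_B$, and either answer is allowed otherwise. A non-deterministic protocol for it with witness set $\mathcal{W}$ is a pair of functions $a:V\times\mathcal{W}\to\{0,1\}$, $b:V\times\mathcal{W}\to\{0,1\}$ such that: if $v_A,v_B$ are neighbors then some $w\in\mathcal{W}$ has $a(v_A,w)=b(v_B,w)=1$, and if $v_A=v_B$ then no such $w$ exists. Its complexity is $\log|\mathcal{W}|$, and $\mathsf{NCC}(\textsc{GraphIneq}_G)$ is the minimal complexity of such a protocol. -}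

module Defs where

open import Level using (Level; suc; _⊔_)
open import Data.Nat using (ℕ; _≤_)
open import Data.Fin using (Fin)
open import Data.Bool using (Bool; true)
open import Data.Product using (Σ; ∃; _×_)
open import Relation.Nullary using (¬_)
open import Relation.Binary.PropositionalEquality using (_≡_)

record Graph (n : ℕ) : Set₁ where
  field
    Adj    : Fin n → Fin n → Set
    sym    : ∀ {u v} → Adj u v → Adj v u
    irrefl : ∀ {v} → ¬ Adj v v

open Graph public

ProperColouring : ∀ {n} → Graph n → ℕ → Set
ProperColouring {n} G c =
  Σ (Fin n → Fin c) λ col → ∀ u v → Adj G u v → ¬ (col u ≡ col v)

IsChromaticNumber : ∀ {n} → Graph n → ℕ → Set
IsChromaticNumber G c =
  ProperColouring G c × (∀ c' → ProperColouring G c' → c ≤ c')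

record NDProtocol {n : ℕ} (G : Graph n) (m : ℕ) : Set where
  field
    a : Fin n → Fin m → Bool
    b : Fin n → Fin m → Bool
    complete : ∀ u v → Adj G u v → ∃ λ w → (a u w ≡ true) × (b v w ≡ true)
    sound    : ∀ v w → ¬ ((a v w ≡ true) × (b v w ≡ true))

-- k is the least witness-set size of a non-deterministic protocol for
-- GraphIneq_G; hence NCC(GraphIneq_G) = log k (with log 0 = -∞).
IsMinWitnessSize : ∀ {n} → Graph n → ℕ → Set
IsMinWitnessSize G k =
  NDProtocol G k × (∀ k' → NDProtocol G k' → k ≤ k')

-- A protocol with witness set W colours each vertex v by its row a(v,·) ∈ 2^W, and properly: a
-- witness w with a(u,w) = b(v,w) = 1 for neighbours u, v forbids a(v,w) = 1.  Conversely, a proper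
-- c-colouring and an antichain S₁, …, S_c of subsets of W give the protocol a(v,w) = [w ∈ S_col(v)],
-- b(v,w) = [w ∉ S_col(v)].  It remains to find such antichains with 2^|W| ≤ c².  Products of
-- antichains multiply their sizes and add their ground sets, so the six 2-subsets of a 4-set turn
-- an antichain for q = ⌊c/4⌋ into one for any c ≤ 6q, and 2⁴ ≤ (c/q)²; for c ≤ 10 explicit
-- antichains suffice.
module Submission where

open import Defs
open import Data.Nat using (ℕ; suc; _≤_; _*_; _^_)
open import Data.Product using (_×_)

open import Data.Nat using (_+_; _<_; _≤ᵇ_; _/_; _%_; z≤n; s≤s)
open import Data.Nat.Properties
open import Data.Nat.DivMod using (m≡m%n+[m/n]*n; m%n<n; m/n*n≤m; m/n<m; /-mono-≤)
open import Data.Nat.Induction using (<-rec)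
open import Data.Nat.Solver using (module +-*-Solver)
open import Data.Fin as Fin using (Fin; zero; inject≤; splitAt; _↑ˡ_; _↑ʳ_; remQuot; combine; funToFin; finToFun)
open import Data.Fin.Properties
  using (toℕ<n; 2↔Bool; finToFun-funToFin; splitAt-↑ˡ; splitAt-↑ʳ; combine-remQuot; inject≤-injective; all?; any?)
open import Data.Bool using (Bool; true; false; not; T)
open import Data.Bool.Properties using (not-¬) renaming (_≟_ to _≟ᵇ_)
open import Data.Product using (∃; _,_; proj₁; proj₂)
open import Data.Sum using (_⊎_; inj₁; inj₂; [_,_]′)
open import Data.Empty using (⊥-elim)
open import Data.Vec using (Vec; []; _∷_; lookup)
open import Function using (_∘_; Injection)
open import Function.Properties.Inverse using (↔-sym; ↔⇒↣)
open import Relation.Nullary using (Dec)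
open import Relation.Nullary.Decidable using (True; toWitness; _⊎-dec_; _×-dec_)
open import Relation.Binary.PropositionalEquality hiding (sym)
open import Relation.Binary.PropositionalEquality as ≡ using ()

funToFin-injective : ∀ {m n} {f g : Fin m → Fin n} → funToFin f ≡ funToFin g → f ≗ g
funToFin-injective {f = f} {g} eq w = begin
  f w                     ≡⟨ finToFun-funToFin f w ⟨
  finToFun (funToFin f) w ≡⟨ cong (λ i → finToFun i w) eq ⟩
  finToFun (funToFin g) w ≡⟨ finToFun-funToFin g w ⟩
  g w                     ∎
  where open ≡-Reasoning

protocol⇒colouring : ∀ {n k} (G : Graph n) → NDProtocol G k → ProperColouring G (2 ^ k)
protocol⇒colouring {n} {k} G P = row , row-proper
  where
  open NDProtocol P
  open Injection (↔⇒↣ (↔-sym 2↔Bool)) using (to; injective)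

  row : Fin n → Fin (2 ^ k)
  row v = funToFin (to ∘ a v)

  row-proper : ∀ u v → Adj G u v → row u ≢ row v
  row-proper u v adj same with w , u∈w , v∈w ← complete u v adj =
    sound v w (trans (≡.sym (injective (funToFin-injective same w))) u∈w , v∈w)

Separating : ∀ {m s} → (Fin m → Fin s → Bool) → Set
Separating f = ∀ i j → i ≡ j ⊎ ∃ λ x → f i x ≡ true × f j x ≡ false

separating? : ∀ {m s} (f : Fin m → Fin s → Bool) → Dec (Separating f)
separating? f = all? λ i → all? λ j →
  (i Fin.≟ j) ⊎-dec any? λ x → (f i x ≟ᵇ true) ×-dec (f j x ≟ᵇ false)

record Antichain (m s : ℕ) : Set where
  field
    member     : Fin m → Fin s → Bool
    separating : Separating member

open Antichain

fromTable : ∀ {m s} (t : Vec (Vec Bool s) m) → True (separating? (lookup ∘ lookup t)) → Antichain m s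
fromTable t ok = record { member = lookup ∘ lookup t ; separating = toWitness ok }

restrict : ∀ {c m s} → c ≤ m → Antichain m s → Antichain c s
restrict c≤m A = record { member = member A ∘ inject ; separating = separating′ }
  where
  inject = λ i → inject≤ i c≤m
  separating′ : Separating (member A ∘ inject)
  separating′ i j with separating A (inject i) (inject j)
  ... | inj₁ eq  = inj₁ (inject≤-injective c≤m c≤m i j eq)
  ... | inj₂ sep = inj₂ sep

_⊗_ : ∀ {m₁ s₁ m₂ s₂} → Antichain m₁ s₁ → Antichain m₂ s₂ → Antichain (m₁ * m₂) (s₁ + s₂)
_⊗_ {m₁} {s₁} {m₂} {s₂} A B = record { member = member′ ; separating = separating′ }
  where
  left  = λ i → proj₁ (remQuot {m₁} m₂ i)
  right = λ i → proj₂ (remQuot {m₁} m₂ i)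

  member′ : Fin (m₁ * m₂) → Fin (s₁ + s₂) → Bool
  member′ i x = [ member A (left i) , member B (right i) ]′ (splitAt s₁ x)

  member′-↑ˡ : ∀ i y → member′ i (y ↑ˡ s₂) ≡ member A (left i) y
  member′-↑ˡ i y = cong [ member A (left i) , member B (right i) ]′ (splitAt-↑ˡ s₁ y s₂)

  member′-↑ʳ : ∀ i y → member′ i (s₁ ↑ʳ y) ≡ member B (right i) y
  member′-↑ʳ i y = cong [ member A (left i) , member B (right i) ]′ (splitAt-↑ʳ s₁ s₂ y)

  separating′ : Separating member′
  separating′ i j with separating A (left i) (left j) | separating B (right i) (right j)
  ... | inj₂ (y , i∋y , j∌y) | _ =
    inj₂ (y ↑ˡ s₂ , trans (member′-↑ˡ i y) i∋y , trans (member′-↑ˡ j y) j∌y)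
  ... | inj₁ _ | inj₂ (y , i∋y , j∌y) =
    inj₂ (s₁ ↑ʳ y , trans (member′-↑ʳ i y) i∋y , trans (member′-↑ʳ j y) j∌y)
  ... | inj₁ eqˡ | inj₁ eqʳ = inj₁ (begin
    i                           ≡⟨ combine-remQuot {m₁} m₂ i ⟨
    combine (left i) (right i)  ≡⟨ cong₂ combine eqˡ eqʳ ⟩
    combine (left j) (right j)  ≡⟨ combine-remQuot {m₁} m₂ j ⟩
    j                           ∎)
    where open ≡-Reasoning

colouring⇒protocol : ∀ {n c s} (G : Graph n) → ProperColouring G c → Antichain c s → NDProtocol G s
colouring⇒protocol G (col , proper) A = record
  { a        = member A ∘ col
  ; b        = λ v → not ∘ member A (col v)
  ; complete = complete
  ; sound    = λ v w (a≡true , b≡true) → not-¬ refl (trans a≡true (≡.sym b≡true))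
  }
  where
  complete : ∀ u v → Adj G u v → ∃ λ w → member A (col u) w ≡ true × not (member A (col v) w) ≡ true
  complete u v adj with separating A (col u) (col v)
  ... | inj₁ same              = ⊥-elim (proper u v adj same)
  ... | inj₂ (w , u∋w , v∌w)   = w , u∋w , cong not v∌w

antichain₁ : Antichain 1 0
antichain₁ = fromTable ([] ∷ []) _

antichain₂ : Antichain 2 2
antichain₂ = fromTable ((true ∷ false ∷ []) ∷ (false ∷ true ∷ []) ∷ []) _

antichain₃ : Antichain 3 3
antichain₃ = fromTable (
  (true  ∷ false ∷ false ∷ []) ∷
  (false ∷ true  ∷ false ∷ []) ∷
  (false ∷ false ∷ true  ∷ []) ∷ []) _

antichain₆ : Antichain 6 4
antichain₆ = fromTable (
  (true  ∷ true  ∷ false ∷ false ∷ []) ∷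
  (true  ∷ false ∷ true  ∷ false ∷ []) ∷
  (true  ∷ false ∷ false ∷ true  ∷ []) ∷
  (false ∷ true  ∷ true  ∷ false ∷ []) ∷
  (false ∷ true  ∷ false ∷ true  ∷ []) ∷
  (false ∷ false ∷ true  ∷ true  ∷ []) ∷ []) _

antichain₁₀ : Antichain 10 5
antichain₁₀ = fromTable (
  (true  ∷ true  ∷ false ∷ false ∷ false ∷ []) ∷
  (true  ∷ false ∷ true  ∷ false ∷ false ∷ []) ∷
  (true  ∷ false ∷ false ∷ true  ∷ false ∷ []) ∷
  (true  ∷ false ∷ false ∷ false ∷ true  ∷ []) ∷
  (false ∷ true  ∷ true  ∷ false ∷ false ∷ []) ∷
  (false ∷ true  ∷ false ∷ true  ∷ false ∷ []) ∷
  (false ∷ true  ∷ false ∷ false ∷ true  ∷ []) ∷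
  (false ∷ false ∷ true  ∷ true  ∷ false ∷ []) ∷
  (false ∷ false ∷ true  ∷ false ∷ true  ∷ []) ∷
  (false ∷ false ∷ false ∷ true  ∷ true  ∷ []) ∷ []) _

SmallAntichain : ℕ → Set
SmallAntichain c = ∃ λ s → Antichain c s × 2 ^ s ≤ c * c

small-by-evaluation : ∀ {c m s} → Antichain m s → {T (c ≤ᵇ m)} → {T (2 ^ s ≤ᵇ c * c)} → SmallAntichain c
small-by-evaluation {c} {m} {s} A {c≤m} {bound} = s , restrict (≤ᵇ⇒≤ c m c≤m) A , ≤ᵇ⇒≤ (2 ^ s) (c * c) bound

small-⊗-antichain₆ : ∀ {q c} → q * 4 ≤ c → c ≤ 6 * q → SmallAntichain q → SmallAntichain c
small-⊗-antichain₆ {q} {c} 4q≤c c≤6q (s , A , 2^s≤q²) = 4 + s , restrict c≤6q (antichain₆ ⊗ A) , 2^4+s≤c²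
  where
  open ≤-Reasoning
  open +-*-Solver
  2^4+s≤c² : 2 ^ (4 + s) ≤ c * c
  2^4+s≤c² = begin
    2 ^ (4 + s)        ≡⟨ ^-distribˡ-+-* 2 4 s ⟩
    16 * 2 ^ s         ≤⟨ *-monoʳ-≤ 16 2^s≤q² ⟩
    16 * (q * q)       ≡⟨ solve 1 (λ x → con 16 :* (x :* x) := (x :* con 4) :* (x :* con 4)) refl q ⟩
    (q * 4) * (q * 4)  ≤⟨ *-mono-≤ 4q≤c 4q≤c ⟩
    c * c              ∎

2≤c/4 : ∀ {c} → 11 ≤ c → 2 ≤ c / 4
2≤c/4 11≤c = /-mono-≤ {o = 4} {p = 4} 11≤c ≤-refl

c≤6*[c/4] : ∀ {c} → 11 ≤ c → c ≤ 6 * (c / 4)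
c≤6*[c/4] {c} 11≤c = begin
  c                      ≡⟨ m≡m%n+[m/n]*n c 4 ⟩
  c % 4 + c / 4 * 4      ≤⟨ +-monoˡ-≤ (c / 4 * 4) (≤-pred (m%n<n c 4)) ⟩
  3 + c / 4 * 4          ≤⟨ +-monoˡ-≤ (c / 4 * 4) (≤-trans (n≤1+n 3) (*-monoʳ-≤ 2 (2≤c/4 11≤c))) ⟩
  2 * (c / 4) + c / 4 * 4 ≡⟨ solve 1 (λ x → con 2 :* x :+ x :* con 4 := con 6 :* x) refl (c / 4) ⟩
  6 * (c / 4)            ∎
  where
  open ≤-Reasoning
  open +-*-Solver

smallAntichain : ∀ c → 1 ≤ c → SmallAntichain c
smallAntichain = <-rec (λ c → 1 ≤ c → SmallAntichain c) go
  where
  go : ∀ c → (∀ {q} → q < c → 1 ≤ q → SmallAntichain q) → 1 ≤ c → SmallAntichain c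
  go 0  _ ()
  go 1  _ _ = small-by-evaluation antichain₁
  go 2  _ _ = small-by-evaluation antichain₂
  go 3  _ _ = small-by-evaluation antichain₃
  go 4  _ _ = small-by-evaluation antichain₆
  go 5  _ _ = small-by-evaluation antichain₆
  go 6  _ _ = small-by-evaluation antichain₆
  go 7  _ _ = small-by-evaluation antichain₁₀
  go 8  _ _ = small-by-evaluation antichain₁₀
  go 9  _ _ = small-by-evaluation antichain₁₀
  go 10 _ _ = small-by-evaluation antichain₁₀
  go c@(suc (suc (suc (suc (suc (suc (suc (suc (suc (suc (suc _))))))))))) rec _ =
    small-⊗-antichain₆ (m/n*n≤m c 4) (c≤6*[c/4] 11≤c) (rec c/4<c 1≤c/4)
    where
    11≤c : 11 ≤ c
    11≤c = m≤m+n 11 _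
    c/4<c : c / 4 < c
    c/4<c = m/n<m c 4 (s≤s (s≤s z≤n))
    1≤c/4 : 1 ≤ c / 4
    1≤c/4 = ≤-trans (n≤1+n 1) (2≤c/4 11≤c)

proposition4p9 : ∀ {n} (G : Graph (suc n)) (c k : ℕ) →
    IsChromaticNumber G c → IsMinWitnessSize G k →
    (c ≤ 2 ^ k) × (2 ^ k ≤ c * c)
proposition4p9 G c k (colouring , χ-minimal) (P , k-minimal) =
  χ-minimal (2 ^ k) (protocol⇒colouring G P) , 2^k≤c²
  where
  1≤c : 1 ≤ c
  1≤c = ≤-<-trans z≤n (toℕ<n (proj₁ colouring zero))
  2^k≤c² : 2 ^ k ≤ c * c
  2^k≤c² with s , A , 2^s≤c² ← smallAntichain c 1≤c =
    ≤-trans (^-monoʳ-≤ 2 (k-minimal s (colouring⇒protocol G colouring A))) 2^s≤c²
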